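{- Let $h:\mathbb{Z}_{\ge0}\to\mathbb{Z}_{\ge0}$ be nondecreasing and satisfy condition (a): for all $z,z'\in\mathbb{Z}_{\ge0}$ and every positive integer $i$, if $\lfloor z/2^i\rfloor=\lfloor z'/2^i\rfloor$ then $\lfloor h(z)/2^{i-1}\rfloor=\lfloor h(z')/2^{i-1}\rfloor$. Consider the impartial game whose positions are triples $\{x,y,z\}$ of nonnegative integers with $y\le h(z)$ and whose moves are $move_h(\{x,y,z\})=\{\{u,y,z\}:u<x\}\cup\{\{x,v,z\}:v<y\}\cup\{\{x,\min(y,h(w)),w\}:w<z\}$, under normal play (a player with no move, i.e. facing $\{0,0,0\}$, loses). Then the set of $\mathcal{P}$-positions is $A_h=\{\{x,y,z\}: y\le h(z),\ x\oplus y\oplus z=0\}$ and the set of $\mathcal{N}$-positions is $B_h=\{\{x,y,z\}: y\le h(z),\ x\oplus y\oplus z\neq 0\}$.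
   Context: $\oplus$ denotes nim-sum (bitwise XOR). This game models the disjunctive sum of a single strip of chocolate of length $x$ to the left of the bitter square and the chocolate bar $CB(h,y,z)$ to the right. A $\mathcal{P}$-position is one from which the previous player can force a win; an $\mathcal{N}$-position is one from which the next player can force a win. -}

module Defs where

open import Data.Nat using (ℕ; zero; suc; _≤_; _<_; _^_; _/_; _⊓_)
open import Data.Nat using (_+_; _*_; _%_)
open import Data.Nat.Properties using (m^n≢0)
open import Data.Product using (Σ; _×_; _,_)
open import Relation.Binary.PropositionalEquality using (_≡_)
open import Relation.Nullary using (¬_)

-- The fuel argument (m + n suffices, since every number below 2^k has at most k bits)
-- only ensures structural termination.
bitXor : ℕ → ℕ → ℕ
bitXor a b = (a + b) % 2

xorFuel : ℕ → ℕ → ℕ → ℕ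
xorFuel zero    m n = 0
xorFuel (suc k) m n = bitXor (m % 2) (n % 2) + 2 * xorFuel k (m / 2) (n / 2)

_⊕_ : ℕ → ℕ → ℕ
m ⊕ n = xorFuel (m + n) m n

infixl 6 _⊕_

_div2^_ : ℕ → ℕ → ℕ
n div2^ i = _/_ n (2 ^ i) {{m^n≢0 2 i}}

-- Condition (a): for all z z' and positive i,
-- ⌊z/2^i⌋ = ⌊z'/2^i⌋ → ⌊h z/2^(i-1)⌋ = ⌊h z'/2^(i-1)⌋   (i = suc j)
ConditionA : (ℕ → ℕ) → Set
ConditionA h = ∀ z z' j → z div2^ suc j ≡ z' div2^ suc j → h z div2^ j ≡ h z' div2^ j

Nondecreasing : (ℕ → ℕ) → Set
Nondecreasing h = ∀ {a b} → a ≤ b → h a ≤ h b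

Pos : Set
Pos = ℕ × ℕ × ℕ

Valid : (ℕ → ℕ) → Pos → Set
Valid h (x , y , z) = y ≤ h z

data Move (h : ℕ → ℕ) : Pos → Pos → Set where
  moveX : ∀ {x y z u} → u < x → Move h (x , y , z) (u , y , z)
  moveY : ∀ {x y z v} → v < y → Move h (x , y , z) (x , v , z)
  moveZ : ∀ {x y z w} → w < z → Move h (x , y , z) (x , y ⊓ h w , w)

mutual
  data IsP (h : ℕ → ℕ) (p : Pos) : Set where
    allMovesToN : (∀ q → Move h p q → IsN h q) → IsP h p

  data IsN (h : ℕ → ℕ) (p : Pos) : Set where
    someMoveToP : (q : Pos) → Move h p q → IsP h q → IsN h p

InA : (ℕ → ℕ) → Pos → Set
InA h (x , y , z) = y ≤ h z × x ⊕ y ⊕ z ≡ 0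

InB : (ℕ → ℕ) → Pos → Set
InB h (x , y , z) = y ≤ h z × ¬ (x ⊕ y ⊕ z ≡ 0)

-- Since x ⊕ y ⊕ z = 0 exactly when x = y ⊕ z, it suffices to show that the
-- component (y, z) behaves like a nim heap of size y ⊕ z: no move of it keeps
-- the value y ⊕ z, and every smaller value is reached by some move.  Both facts
-- are proved by induction on binary length, stripping the last bit of y, z and
-- of the target value.  Condition (a) is what makes this possible: for i = 1 it
-- says that h w depends only on ⌊w/2⌋, and the halved function
-- W ↦ ⌊h(2W)/2⌋ satisfies condition (a) again, so the halved position is a
-- position of the same kind of game.
module Submission where

open import Defs
open import Data.Nat using (ℕ; zero; suc; _≟_; _+_; _*_; _%_; _/_; _^_; _⊓_; _≤_; _<_; z≤n; s≤s)
open import Data.Nat.Properties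
open import Data.Nat.DivMod
open import Data.Nat.Divisibility using (n∣m*n)
open import Data.Nat.Induction using (<-wellFounded)
open import Data.Product using (_×_; _,_; proj₁; proj₂; ∃-syntax)
open import Data.Sum using (_⊎_; inj₁; inj₂)
open import Function.Bundles using (_⇔_; mk⇔)
open import Induction.WellFounded using (Acc; acc)
open import Relation.Binary.Definitions using (tri<; tri≈; tri>)
open import Relation.Binary.PropositionalEquality
open import Relation.Nullary using (¬_; yes; no; contradiction)
open import Relation.Unary using (Decidable)

m≡m%2+2*[m/2] : ∀ m → m ≡ m % 2 + 2 * (m / 2)
m≡m%2+2*[m/2] m = trans (m≡m%n+[m/n]*n m 2) (cong (m % 2 +_) (*-comm (m / 2) 2))

[b+2*q]%2≡b : ∀ {b} q → b < 2 → (b + 2 * q) % 2 ≡ b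
[b+2*q]%2≡b {b} q b<2 = begin
  (b + 2 * q) % 2  ≡⟨ cong (λ t → (b + t) % 2) (*-comm 2 q) ⟩
  (b + q * 2) % 2  ≡⟨ [m+kn]%n≡m%n b q 2 ⟩
  b % 2            ≡⟨ m<n⇒m%n≡m b<2 ⟩
  b                ∎
  where open ≡-Reasoning

[b+2*q]/2≡q : ∀ {b} q → b < 2 → (b + 2 * q) / 2 ≡ q
[b+2*q]/2≡q {b} q b<2 = begin
  (b + 2 * q) / 2    ≡⟨ cong (λ t → (b + t) / 2) (*-comm 2 q) ⟩
  (b + q * 2) / 2    ≡⟨ +-distrib-/-∣ʳ b (n∣m*n q) ⟩
  b / 2 + q * 2 / 2  ≡⟨ cong₂ _+_ (m<n⇒m/n≡0 b<2) (m*n/n≡m q 2) ⟩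
  q                  ∎
  where open ≡-Reasoning

≡-by-%2-/2 : ∀ {m n} → m % 2 ≡ n % 2 → m / 2 ≡ n / 2 → m ≡ n
≡-by-%2-/2 {m} {n} m%2≡n%2 m/2≡n/2 = begin
  m                   ≡⟨ m≡m%2+2*[m/2] m ⟩
  m % 2 + 2 * (m / 2) ≡⟨ cong₂ (λ b q → b + 2 * q) m%2≡n%2 m/2≡n/2 ⟩
  n % 2 + 2 * (n / 2) ≡⟨ m≡m%2+2*[m/2] n ⟨
  n                   ∎
  where open ≡-Reasoning

m≤1+n⇒m/2≤n : ∀ {m n} → m ≤ suc n → m / 2 ≤ n
m≤1+n⇒m/2≤n {m} {n} m≤1+n =
  ≤-trans (/-monoˡ-≤ 2 m≤1+n) (≤-pred (m/n<m (suc n) 2 (s≤s (s≤s z≤n))))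

m/2+n/2≤[m+n]/2 : ∀ m n → m / 2 + n / 2 ≤ (m + n) / 2
m/2+n/2≤[m+n]/2 m n =
  subst (_≤ (m + n) / 2) (m*n/n≡m (m / 2 + n / 2) 2) (/-monoˡ-≤ 2 doubled≤)
  where
  doubled≤ : (m / 2 + n / 2) * 2 ≤ m + n
  doubled≤ = ≤-trans (≤-reflexive (*-distribʳ-+ 2 (m / 2) (n / 2)))
                     (+-mono-≤ (m/n*n≤m m 2) (m/n*n≤m n 2))

m+n≤1+k⇒m/2+n/2≤k : ∀ m n {k} → m + n ≤ suc k → m / 2 + n / 2 ≤ k
m+n≤1+k⇒m/2+n/2≤k m n m+n≤1+k = ≤-trans (m/2+n/2≤[m+n]/2 m n) (m≤1+n⇒m/2≤n m+n≤1+k)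

xorFuel-0-0 : ∀ k → xorFuel k 0 0 ≡ 0
xorFuel-0-0 zero    = refl
xorFuel-0-0 (suc k) = cong (2 *_) (xorFuel-0-0 k)

xorFuel-irrelevant : ∀ {k k'} m n → m + n ≤ k → m + n ≤ k' → xorFuel k m n ≡ xorFuel k' m n
xorFuel-irrelevant {k} {k'} zero zero _ _ = trans (xorFuel-0-0 k) (sym (xorFuel-0-0 k'))
xorFuel-irrelevant {zero}         (suc m) n ()  _
xorFuel-irrelevant {zero}         zero (suc n) () _
xorFuel-irrelevant {suc k} {zero} (suc m) n _   ()
xorFuel-irrelevant {suc k} {zero} zero (suc n) _ ()
xorFuel-irrelevant {suc k} {suc k'} m n m+n≤k m+n≤k' =
  cong (λ t → bitXor (m % 2) (n % 2) + 2 * t)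
    (xorFuel-irrelevant (m / 2) (n / 2)
      (m+n≤1+k⇒m/2+n/2≤k m n m+n≤k) (m+n≤1+k⇒m/2+n/2≤k m n m+n≤k'))

⊕-unfold : ∀ m n → m ⊕ n ≡ bitXor (m % 2) (n % 2) + 2 * (m / 2 ⊕ n / 2)
⊕-unfold zero    zero    = refl
⊕-unfold (suc m) n       = cong (λ t → bitXor (suc m % 2) (n % 2) + 2 * t)
  (xorFuel-irrelevant (suc m / 2) (n / 2) (m+n≤1+k⇒m/2+n/2≤k (suc m) n ≤-refl) ≤-refl)
⊕-unfold zero    (suc n) = cong (λ t → bitXor 0 (suc n % 2) + 2 * t)
  (xorFuel-irrelevant 0 (suc n / 2) (m+n≤1+k⇒m/2+n/2≤k 0 (suc n) ≤-refl) ≤-refl)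

bitXor<2 : ∀ a b → bitXor a b < 2
bitXor<2 a b = m%n<n (a + b) 2

⊕-%2 : ∀ m n → (m ⊕ n) % 2 ≡ bitXor (m % 2) (n % 2)
⊕-%2 m n = trans (cong (_% 2) (⊕-unfold m n)) ([b+2*q]%2≡b (m / 2 ⊕ n / 2) (bitXor<2 (m % 2) (n % 2)))

⊕-/2 : ∀ m n → (m ⊕ n) / 2 ≡ m / 2 ⊕ n / 2
⊕-/2 m n = trans (cong (_/ 2) (⊕-unfold m n)) ([b+2*q]/2≡q (m / 2 ⊕ n / 2) (bitXor<2 (m % 2) (n % 2)))

bitXor-comm : ∀ a b → bitXor a b ≡ bitXor b a
bitXor-comm a b = cong (_% 2) (+-comm a b)

bitXor-assoc : ∀ a b c → bitXor (bitXor a b) c ≡ bitXor a (bitXor b c)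
bitXor-assoc a b c = begin
  ((a + b) % 2 + c) % 2        ≡⟨ %-distribˡ-+ ((a + b) % 2) c 2 ⟩
  ((a + b) % 2 % 2 + c % 2) % 2 ≡⟨ cong (λ t → (t + c % 2) % 2) (m%n%n≡m%n (a + b) 2) ⟩
  ((a + b) % 2 + c % 2) % 2     ≡⟨ %-distribˡ-+ (a + b) c 2 ⟨
  (a + b + c) % 2               ≡⟨ cong (_% 2) (+-assoc a b c) ⟩
  (a + (b + c)) % 2             ≡⟨ %-distribˡ-+ a (b + c) 2 ⟩
  (a % 2 + (b + c) % 2) % 2     ≡⟨ cong (λ t → (a % 2 + t) % 2) (m%n%n≡m%n (b + c) 2) ⟨
  (a % 2 + (b + c) % 2 % 2) % 2 ≡⟨ %-distribˡ-+ a ((b + c) % 2) 2 ⟨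
  (a + (b + c) % 2) % 2         ∎
  where open ≡-Reasoning

bitXor-same : ∀ a → bitXor a a ≡ 0
bitXor-same a = begin
  (a + a) % 2       ≡⟨ cong (λ t → (a + t) % 2) (+-identityʳ a) ⟨
  (a + (a + 0)) % 2 ≡⟨ cong (_% 2) (*-comm 2 a) ⟩
  a * 2 % 2         ≡⟨ m*n%n≡0 a 2 ⟩
  0                 ∎
  where open ≡-Reasoning

bitXor-identityʳ : ∀ a → bitXor (a % 2) 0 ≡ a % 2
bitXor-identityʳ a = trans (cong (_% 2) (+-identityʳ (a % 2))) (m%n%n≡m%n a 2)

bitXor-cancelʳ : ∀ a b → bitXor (bitXor (a % 2) b) b ≡ a % 2
bitXor-cancelʳ a b = begin
  bitXor (bitXor (a % 2) b) b ≡⟨ bitXor-assoc (a % 2) b b ⟩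
  bitXor (a % 2) (bitXor b b) ≡⟨ cong (bitXor (a % 2)) (bitXor-same b) ⟩
  bitXor (a % 2) 0            ≡⟨ bitXor-identityʳ a ⟩
  a % 2                       ∎
  where open ≡-Reasoning

halving-induction : (P : ℕ → ℕ → ℕ → Set) → P 0 0 0 →
  (∀ {a b c} → P (a / 2) (b / 2) (c / 2) → P a b c) → ∀ a b c → P a b c
halving-induction P base step a b c =
  go (a + b + c) (≤-trans (m≤m+n a b) (m≤m+n (a + b) c))
                 (≤-trans (m≤n+m b a) (m≤m+n (a + b) c)) (m≤n+m c (a + b))
  where
  go : ∀ n {a b c} → a ≤ n → b ≤ n → c ≤ n → P a b c
  go zero    z≤n z≤n z≤n = base
  go (suc n) a≤ b≤ c≤    = step (go n (m≤1+n⇒m/2≤n a≤) (m≤1+n⇒m/2≤n b≤) (m≤1+n⇒m/2≤n c≤))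

⊕-comm : ∀ m n → m ⊕ n ≡ n ⊕ m
⊕-comm m n = halving-induction (λ m n _ → m ⊕ n ≡ n ⊕ m) refl
  (λ {m} {n} ih → ≡-by-%2-/2
    (trans (⊕-%2 m n) (trans (bitXor-comm (m % 2) (n % 2)) (sym (⊕-%2 n m))))
    (trans (⊕-/2 m n) (trans ih (sym (⊕-/2 n m)))))
  m n 0

⊕-assoc : ∀ l m n → l ⊕ m ⊕ n ≡ l ⊕ (m ⊕ n)
⊕-assoc = halving-induction (λ l m n → l ⊕ m ⊕ n ≡ l ⊕ (m ⊕ n)) refl
  (λ {l} {m} {n} ih → ≡-by-%2-/2 (parity l m n) (begin
    (l ⊕ m ⊕ n) / 2         ≡⟨ trans (⊕-/2 (l ⊕ m) n) (cong (_⊕ n / 2) (⊕-/2 l m)) ⟩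
    l / 2 ⊕ m / 2 ⊕ n / 2   ≡⟨ ih ⟩
    l / 2 ⊕ (m / 2 ⊕ n / 2) ≡⟨ trans (⊕-/2 l (m ⊕ n)) (cong (l / 2 ⊕_) (⊕-/2 m n)) ⟨
    (l ⊕ (m ⊕ n)) / 2       ∎))
  where
  open ≡-Reasoning
  parity : ∀ l m n → (l ⊕ m ⊕ n) % 2 ≡ (l ⊕ (m ⊕ n)) % 2
  parity l m n = begin
    (l ⊕ m ⊕ n) % 2                        ≡⟨ trans (⊕-%2 (l ⊕ m) n) (cong (λ t → bitXor t (n % 2)) (⊕-%2 l m)) ⟩
    bitXor (bitXor (l % 2) (m % 2)) (n % 2) ≡⟨ bitXor-assoc (l % 2) (m % 2) (n % 2) ⟩
    bitXor (l % 2) (bitXor (m % 2) (n % 2)) ≡⟨ trans (⊕-%2 l (m ⊕ n)) (cong (bitXor (l % 2)) (⊕-%2 m n)) ⟨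
    (l ⊕ (m ⊕ n)) % 2                      ∎

⊕-same : ∀ m → m ⊕ m ≡ 0
⊕-same m = halving-induction (λ m _ _ → m ⊕ m ≡ 0) refl
  (λ {m} ih → ≡-by-%2-/2 (trans (⊕-%2 m m) (bitXor-same (m % 2))) (trans (⊕-/2 m m) ih))
  m 0 0

⊕-identityʳ : ∀ m → m ⊕ 0 ≡ m
⊕-identityʳ m = halving-induction (λ m _ _ → m ⊕ 0 ≡ m) refl
  (λ {m} ih → ≡-by-%2-/2 (trans (⊕-%2 m 0) (bitXor-identityʳ m)) (trans (⊕-/2 m 0) ih))
  m 0 0

⊕-cancelʳ : ∀ l m n → l ⊕ n ≡ m ⊕ n → l ≡ m
⊕-cancelʳ l m n eq = trans (sym (⊕-⊕-cancel l)) (trans (cong (_⊕ n) eq) (⊕-⊕-cancel m))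
  where
  ⊕-⊕-cancel : ∀ k → k ⊕ n ⊕ n ≡ k
  ⊕-⊕-cancel k = trans (⊕-assoc k n n) (trans (cong (k ⊕_) (⊕-same n)) (⊕-identityʳ k))

⊕-cancelˡ : ∀ l m n → n ⊕ l ≡ n ⊕ m → l ≡ m
⊕-cancelˡ l m n eq = ⊕-cancelʳ l m n (trans (⊕-comm l n) (trans eq (⊕-comm n m)))

x⊕y⊕z≡0⇒x≡y⊕z : ∀ x y z → x ⊕ y ⊕ z ≡ 0 → x ≡ y ⊕ z
x⊕y⊕z≡0⇒x≡y⊕z x y z eq = ⊕-cancelʳ x (y ⊕ z) (y ⊕ z) (begin
  x ⊕ (y ⊕ z)       ≡⟨ ⊕-assoc x y z ⟨
  x ⊕ y ⊕ z         ≡⟨ eq ⟩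
  0                 ≡⟨ ⊕-same (y ⊕ z) ⟨
  (y ⊕ z) ⊕ (y ⊕ z) ∎)
  where open ≡-Reasoning

x≡y⊕z⇒x⊕y⊕z≡0 : ∀ x y z → x ≡ y ⊕ z → x ⊕ y ⊕ z ≡ 0
x≡y⊕z⇒x⊕y⊕z≡0 .(y ⊕ z) y z refl = trans (⊕-assoc (y ⊕ z) y z) (⊕-same (y ⊕ z))

%2-cases : ∀ n → n % 2 ≡ 0 ⊎ n % 2 ≡ 1
%2-cases n with n % 2 | m%n<n n 2
... | 0 | _ = inj₁ refl
... | 1 | _ = inj₂ refl
... | suc (suc _) | s≤s (s≤s ())

bitXor-≡1 : ∀ m n → bitXor (m % 2) (n % 2) ≡ 1 → m % 2 ≡ 1 ⊎ n % 2 ≡ 1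
bitXor-≡1 m n eq with %2-cases m
... | inj₂ m%2≡1 = inj₁ m%2≡1
... | inj₁ m%2≡0 = inj₂ (trans (sym (m%n%n≡m%n n 2)) (subst (λ b → bitXor b (n % 2) ≡ 1) m%2≡0 eq))

n/2<n : ∀ {n} → 0 < n → n / 2 < n
n/2<n {suc n} _ = m/n<m (suc n) 2 (s≤s (s≤s z≤n))

m/2<n/2⇒m<n : ∀ {m n} → m / 2 < n / 2 → m < n
m/2<n/2⇒m<n m/2<n/2 = ≰⇒> (λ n≤m → <⇒≱ m/2<n/2 (/-monoˡ-≤ 2 n≤m))

m/2≡n/2⇒m≤n : ∀ {m n} → m / 2 ≡ n / 2 → n % 2 ≡ 1 → m ≤ n
m/2≡n/2⇒m≤n {m} {n} m/2≡n/2 n%2≡1 = begin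
  m                   ≡⟨ m≡m%2+2*[m/2] m ⟩
  m % 2 + 2 * (m / 2) ≤⟨ +-mono-≤ (≤-pred (m%n<n m 2)) (≤-reflexive (cong (2 *_) m/2≡n/2)) ⟩
  1 + 2 * (n / 2)     ≡⟨ cong (_+ 2 * (n / 2)) n%2≡1 ⟨
  n % 2 + 2 * (n / 2) ≡⟨ m≡m%2+2*[m/2] n ⟨
  n                   ∎
  where open ≤-Reasoning

m<n∧m/2≡n/2⇒n%2≡1 : ∀ {m n} → m < n → m / 2 ≡ n / 2 → n % 2 ≡ 1
m<n∧m/2≡n/2⇒n%2≡1 {m} {n} m<n m/2≡n/2 with %2-cases n
... | inj₂ n%2≡1 = n%2≡1
... | inj₁ n%2≡0 = contradiction m<n (≤⇒≯ (begin
  n               ≡⟨ m≡m%2+2*[m/2] n ⟩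
  n % 2 + 2 * (n / 2) ≡⟨ cong₂ (λ b q → b + 2 * q) n%2≡0 (sym m/2≡n/2) ⟩
  2 * (m / 2)     ≤⟨ m≤n+m (2 * (m / 2)) (m % 2) ⟩
  m % 2 + 2 * (m / 2) ≡⟨ m≡m%2+2*[m/2] m ⟨
  m               ∎))
  where open ≤-Reasoning

[2*q]/2≡q : ∀ q → 2 * q / 2 ≡ q
[2*q]/2≡q q = [b+2*q]/2≡q {0} q (s≤s z≤n)

div2^-suc : ∀ n j → (n / 2) div2^ j ≡ n div2^ suc j
div2^-suc n j = m/n/o≡m/[n*o] n 2 (2 ^ j) {{_}} {{m^n≢0 2 j}} {{m^n≢0 2 (suc j)}}

conditionA-respects-halves : ∀ {h} → ConditionA h → ∀ {w w'} → w / 2 ≡ w' / 2 → h w ≡ h w'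
conditionA-respects-halves {h} ca {w} {w'} w/2≡w'/2 = begin
  h w      ≡⟨ n/1≡n (h w) ⟨
  h w / 1  ≡⟨ ca w w' 0 w/2≡w'/2 ⟩
  h w' / 1 ≡⟨ n/1≡n (h w') ⟩
  h w'     ∎
  where open ≡-Reasoning

halve : (ℕ → ℕ) → ℕ → ℕ
halve h w = h (2 * w) / 2

halve-conditionA : ∀ {h} → ConditionA h → ConditionA (halve h)
halve-conditionA {h} ca w w' j eq = begin
  (h (2 * w) / 2) div2^ j ≡⟨ div2^-suc (h (2 * w)) j ⟩
  h (2 * w) div2^ suc j   ≡⟨ ca (2 * w) (2 * w') (suc j) (doubled-halves-agree) ⟩
  h (2 * w') div2^ suc j  ≡⟨ div2^-suc (h (2 * w')) j ⟨
  (h (2 * w') / 2) div2^ j ∎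
  where
  open ≡-Reasoning
  doubled-halves-agree : (2 * w) div2^ suc (suc j) ≡ (2 * w') div2^ suc (suc j)
  doubled-halves-agree = begin
    (2 * w) div2^ suc (suc j) ≡⟨ div2^-suc (2 * w) (suc j) ⟨
    (2 * w / 2) div2^ suc j   ≡⟨ cong (_div2^ suc j) ([2*q]/2≡q w) ⟩
    w div2^ suc j             ≡⟨ eq ⟩
    w' div2^ suc j            ≡⟨ cong (_div2^ suc j) ([2*q]/2≡q w') ⟨
    (2 * w' / 2) div2^ suc j  ≡⟨ div2^-suc (2 * w') (suc j) ⟩
    (2 * w') div2^ suc (suc j) ∎

halve-/2 : ∀ {h} → ConditionA h → ∀ w → h w / 2 ≡ halve h (w / 2)
halve-/2 ca w = cong (_/ 2) (conditionA-respects-halves ca (sym ([2*q]/2≡q (w / 2))))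

⊓-/2 : ∀ m n → (m ⊓ n) / 2 ≡ (m / 2) ⊓ (n / 2)
⊓-/2 = mono-≤-distrib-⊓ {_/ 2} (/-monoˡ-≤ 2)

valid-/2 : ∀ {h} → ConditionA h → ∀ {y z} → y ≤ h z → y / 2 ≤ halve h (z / 2)
valid-/2 ca {y} {z} y≤hz = subst (y / 2 ≤_) (halve-/2 ca z) (/-monoˡ-≤ 2 y≤hz)

⊓h-/2 : ∀ {h} → ConditionA h → ∀ y w → (y ⊓ h w) / 2 ≡ (y / 2) ⊓ halve h (w / 2)
⊓h-/2 {h} ca y w = trans (⊓-/2 y (h w)) (cong ((y / 2) ⊓_) (halve-/2 ca w))

⊕-liftˡ : ∀ a g V → V ⊕ a / 2 ≡ g / 2 → ∃[ v ] v / 2 ≡ V × v ⊕ a ≡ g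
⊕-liftˡ a g V eq = v , v/2≡V , ≡-by-%2-/2 parity halves
  where
  open ≡-Reasoning
  b<2 : bitXor (g % 2) (a % 2) < 2
  b<2 = bitXor<2 (g % 2) (a % 2)
  v : ℕ
  v = bitXor (g % 2) (a % 2) + 2 * V
  v/2≡V : v / 2 ≡ V
  v/2≡V = [b+2*q]/2≡q V b<2
  parity : (v ⊕ a) % 2 ≡ g % 2
  parity = begin
    (v ⊕ a) % 2                             ≡⟨ ⊕-%2 v a ⟩
    bitXor (v % 2) (a % 2)                  ≡⟨ cong (λ c → bitXor c (a % 2)) ([b+2*q]%2≡b V b<2) ⟩
    bitXor (bitXor (g % 2) (a % 2)) (a % 2) ≡⟨ bitXor-cancelʳ g (a % 2) ⟩
    g % 2                                   ∎
  halves : (v ⊕ a) / 2 ≡ g / 2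
  halves = trans (⊕-/2 v a) (trans (cong (_⊕ a / 2) v/2≡V) eq)

⊕-liftʳ : ∀ a g W → a / 2 ⊕ W ≡ g / 2 → ∃[ w ] w / 2 ≡ W × a ⊕ w ≡ g
⊕-liftʳ a g W eq with ⊕-liftˡ a g W (trans (⊕-comm W (a / 2)) eq)
... | w , w/2≡W , w⊕a≡g = w , w/2≡W , trans (⊕-comm a w) w⊕a≡g

moveZ-changes-⊕ : ∀ {h} → ConditionA h → ∀ {y z w} → y ≤ h z → w < z →
  (y ⊓ h w) ⊕ w ≢ y ⊕ z
moveZ-changes-⊕ ca = go (<-wellFounded _) ca
  where
  go : ∀ {h y z w} → Acc _<_ z → ConditionA h → y ≤ h z → w < z → (y ⊓ h w) ⊕ w ≢ y ⊕ z
  go {h} {y} {z} {w} (acc rs) ca y≤hz w<z eq with m≤n⇒m<n∨m≡n (/-monoˡ-≤ 2 (<⇒≤ w<z))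
  ... | inj₂ w/2≡z/2 = <⇒≢ w<z (⊕-cancelˡ w z y (trans (cong (_⊕ w) (sym y⊓hw≡y)) eq))
    where
    y⊓hw≡y : y ⊓ h w ≡ y
    y⊓hw≡y = m≤n⇒m⊓n≡m (subst (y ≤_) (conditionA-respects-halves ca (sym w/2≡z/2)) y≤hz)
  ... | inj₁ w/2<z/2 =
    go (rs (n/2<n (m<n⇒0<n w<z))) (halve-conditionA ca) (valid-/2 ca y≤hz) w/2<z/2 (begin
    (y / 2 ⊓ halve h (w / 2)) ⊕ w / 2 ≡⟨ cong (_⊕ w / 2) (⊓h-/2 ca y w) ⟨
    (y ⊓ h w) / 2 ⊕ w / 2             ≡⟨ ⊕-/2 (y ⊓ h w) w ⟨
    ((y ⊓ h w) ⊕ w) / 2               ≡⟨ cong (_/ 2) eq ⟩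
    (y ⊕ z) / 2                       ≡⟨ ⊕-/2 y z ⟩
    y / 2 ⊕ z / 2                     ∎)
    where open ≡-Reasoning

data ReachesValue (h : ℕ → ℕ) (y z g : ℕ) : Set where
  viaY : ∀ v → v < y → v ⊕ z ≡ g → ReachesValue h y z g
  viaZ : ∀ w → w < z → (y ⊓ h w) ⊕ w ≡ g → ReachesValue h y z g

ReachesValue-lift : ∀ {h} → ConditionA h → ∀ {y z g} →
  ReachesValue (halve h) (y / 2) (z / 2) (g / 2) → ReachesValue h y z g
ReachesValue-lift {h} ca {y} {z} {g} (viaY V V<y/2 V⊕z/2≡g/2) with ⊕-liftˡ z g V V⊕z/2≡g/2
... | v , refl , v⊕z≡g = viaY v (m/2<n/2⇒m<n V<y/2) v⊕z≡g
ReachesValue-lift {h} ca {y} {z} {g} (viaZ W W<z/2 eq)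
  with ⊕-liftʳ (y ⊓ h (2 * W)) g W (trans (cong (_⊕ W) (⊓-/2 y (h (2 * W)))) eq)
... | w , refl , eq′ = viaZ w (m/2<n/2⇒m<n W<z/2)
  (subst (λ t → (y ⊓ t) ⊕ w ≡ g) (conditionA-respects-halves ca ([2*q]/2≡q (w / 2))) eq′)

ReachesValue-lowBit : ∀ {h} → ConditionA h → ∀ {y z g} → y ≤ h z → g < y ⊕ z →
  g / 2 ≡ (y ⊕ z) / 2 → ReachesValue h y z g
-- g and y ⊕ z differ only in the last bit, which is set in y ⊕ z and hence in
-- one of y and z; clearing it there reaches g.
ReachesValue-lowBit {h} ca {y} {z} {g} y≤hz g<y⊕z g/2≡[y⊕z]/2
  with bitXor-≡1 y z (trans (sym (⊕-%2 y z)) (m<n∧m/2≡n/2⇒n%2≡1 g<y⊕z g/2≡[y⊕z]/2))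
... | inj₁ y%2≡1 with ⊕-liftˡ z g (y / 2) (sym (trans g/2≡[y⊕z]/2 (⊕-/2 y z)))
...   | v , v/2≡y/2 , v⊕z≡g =
  viaY v (≤∧≢⇒< (m/2≡n/2⇒m≤n v/2≡y/2 y%2≡1) (λ { refl → <⇒≢ g<y⊕z (sym v⊕z≡g) })) v⊕z≡g
ReachesValue-lowBit {h} ca {y} {z} {g} y≤hz g<y⊕z g/2≡[y⊕z]/2
    | inj₂ z%2≡1 with ⊕-liftʳ y g (z / 2) (sym (trans g/2≡[y⊕z]/2 (⊕-/2 y z)))
...   | w , w/2≡z/2 , y⊕w≡g =
  viaZ w (≤∧≢⇒< (m/2≡n/2⇒m≤n w/2≡z/2 z%2≡1) (λ { refl → <⇒≢ g<y⊕z (sym y⊕w≡g) }))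
    (subst (λ t → t ⊕ w ≡ g) (sym (m≤n⇒m⊓n≡m y≤hw)) y⊕w≡g)
  where
  y≤hw : y ≤ h w
  y≤hw = subst (y ≤_) (conditionA-respects-halves ca (sym w/2≡z/2)) y≤hz

smaller-values-reachable : ∀ {h} → ConditionA h → ∀ {y z g} → y ≤ h z → g < y ⊕ z →
  ReachesValue h y z g
smaller-values-reachable ca = go (<-wellFounded _) ca
  where
  go : ∀ {h y z g} → Acc _<_ (y ⊕ z) → ConditionA h → y ≤ h z → g < y ⊕ z → ReachesValue h y z g
  go {y = y} {z} {g} (acc rs) ca y≤hz g<y⊕z with m≤n⇒m<n∨m≡n (/-monoˡ-≤ 2 (<⇒≤ g<y⊕z))
  ... | inj₂ g/2≡[y⊕z]/2 = ReachesValue-lowBit ca y≤hz g<y⊕z g/2≡[y⊕z]/2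
  ... | inj₁ g/2<[y⊕z]/2 = ReachesValue-lift ca
    (go (rs (subst (_< y ⊕ z) (⊕-/2 y z) (n/2<n (m<n⇒0<n g<y⊕z))))
        (halve-conditionA ca) (valid-/2 ca y≤hz) (subst (g / 2 <_) (⊕-/2 y z) g/2<[y⊕z]/2))

size : Pos → ℕ
size (x , y , z) = x + y + z

Move⇒size< : ∀ {h p q} → Move h p q → size q < size p
Move⇒size< {p = x , y , z} (moveX u<x) = +-monoˡ-< z (+-monoˡ-< y u<x)
Move⇒size< {p = x , y , z} (moveY v<y) = +-monoˡ-< z (+-monoʳ-< x v<y)
Move⇒size< {h} {p = x , y , z} (moveZ {w = w} w<z) = +-mono-≤-< (+-monoʳ-≤ x (m⊓n≤m y (h w))) w<z

Move-preserves-Valid : ∀ {h p q} → Valid h p → Move h p q → Valid h q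
Move-preserves-Valid y≤hz (moveX _)   = y≤hz
Move-preserves-Valid y≤hz (moveY v<y) = ≤-trans (<⇒≤ v<y) y≤hz
Move-preserves-Valid {h} {x , y , z} _ (moveZ {w = w} _) = m⊓n≤n y (h w)

IsP⇒¬IsN : ∀ {h p} → IsP h p → ¬ IsN h p
IsP⇒¬IsN (allMovesToN toN) (someMoveToP q p→q isP) = IsP⇒¬IsN isP (toN q p→q)

module Classification {h : ℕ → ℕ} {Z : Pos → Set} (Z? : Decidable Z)
  (Z-leave : ∀ {p q} → Valid h p → Z p → Move h p q → ¬ Z q)
  (Z-enter : ∀ {p} → Valid h p → ¬ Z p → ∃[ q ] Move h p q × Z q) where

  classify : ∀ {p} → Valid h p → (Z p → IsP h p) × (¬ Z p → IsN h p)
  classify = go (<-wellFounded _)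
    where
    go : ∀ {p} → Acc _<_ (size p) → Valid h p → (Z p → IsP h p) × (¬ Z p → IsN h p)
    go {p} (acc rs) valid = Z⇒IsP , ¬Z⇒IsN
      where
      go-option : ∀ {q} → Move h p q → (Z q → IsP h q) × (¬ Z q → IsN h q)
      go-option p→q = go (rs (Move⇒size< p→q)) (Move-preserves-Valid valid p→q)
      Z⇒IsP : Z p → IsP h p
      Z⇒IsP zp = allMovesToN λ q p→q → proj₂ (go-option p→q) (Z-leave valid zp p→q)
      ¬Z⇒IsN : ¬ Z p → IsN h p
      ¬Z⇒IsN ¬zp with Z-enter valid ¬zp
      ... | q , p→q , zq = someMoveToP q p→q (proj₁ (go-option p→q) zq)

  IsP⇔Valid×Z : ∀ {p} → Valid h p → IsP h p ⇔ (Valid h p × Z p)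
  IsP⇔Valid×Z {p} valid = mk⇔ (λ isP → valid , IsP⇒Z isP) (λ (_ , zp) → proj₁ (classify valid) zp)
    where
    IsP⇒Z : IsP h p → Z p
    IsP⇒Z isP with Z? p
    ... | yes zp = zp
    ... | no ¬zp = contradiction (proj₂ (classify valid) ¬zp) (IsP⇒¬IsN isP)

  IsN⇔Valid×¬Z : ∀ {p} → Valid h p → IsN h p ⇔ (Valid h p × ¬ Z p)
  IsN⇔Valid×¬Z valid = mk⇔
    (λ isN → valid , λ zp → IsP⇒¬IsN (proj₁ (classify valid) zp) isN)
    (λ (_ , ¬zp) → proj₂ (classify valid) ¬zp)

nimSum : Pos → ℕ
nimSum (x , y , z) = x ⊕ y ⊕ z

nimSum≡0⇒options≢0 : ∀ {h} → ConditionA h → ∀ {p q} → Valid h p → nimSum p ≡ 0 →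
  Move h p q → nimSum q ≢ 0
nimSum≡0⇒options≢0 {h} ca {x , y , z} y≤hz p≡0 = leaves (x⊕y⊕z≡0⇒x≡y⊕z x y z p≡0)
  where
  leaves : ∀ {q} → x ≡ y ⊕ z → Move h (x , y , z) q → nimSum q ≢ 0
  leaves x≡y⊕z (moveX {u = u} u<x) q≡0 =
    <⇒≢ u<x (trans (x⊕y⊕z≡0⇒x≡y⊕z u y z q≡0) (sym x≡y⊕z))
  leaves x≡y⊕z (moveY {v = v} v<y) q≡0 =
    <⇒≢ v<y (⊕-cancelʳ v y z (trans (sym (x⊕y⊕z≡0⇒x≡y⊕z x v z q≡0)) x≡y⊕z))
  leaves x≡y⊕z (moveZ {w = w} w<z) q≡0 =
    moveZ-changes-⊕ ca y≤hz w<z (trans (sym (x⊕y⊕z≡0⇒x≡y⊕z x (y ⊓ h w) w q≡0)) x≡y⊕z)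

nimSum≢0⇒option≡0 : ∀ {h} → ConditionA h → ∀ {p} → Valid h p → nimSum p ≢ 0 →
  ∃[ q ] Move h p q × nimSum q ≡ 0
nimSum≢0⇒option≡0 {h} ca {x , y , z} y≤hz p≢0 with <-cmp x (y ⊕ z)
... | tri≈ _ x≡y⊕z _ = contradiction (x≡y⊕z⇒x⊕y⊕z≡0 x y z x≡y⊕z) p≢0
... | tri> _ _ y⊕z<x = (y ⊕ z , y , z) , moveX y⊕z<x , x≡y⊕z⇒x⊕y⊕z≡0 (y ⊕ z) y z refl
... | tri< x<y⊕z _ _ with smaller-values-reachable ca y≤hz x<y⊕z
...   | viaY v v<y v⊕z≡x = (x , v , z) , moveY v<y , x≡y⊕z⇒x⊕y⊕z≡0 x v z (sym v⊕z≡x)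
...   | viaZ w w<z y′⊕w≡x =
  (x , y ⊓ h w , w) , moveZ w<z , x≡y⊕z⇒x⊕y⊕z≡0 x (y ⊓ h w) w (sym y′⊕w≡x)

mainTheorem3 : (h : ℕ → ℕ) → Nondecreasing h → ConditionA h →
    ((p : Pos) → Valid h p → (IsP h p ⇔ InA h p))
    × ((p : Pos) → Valid h p → (IsN h p ⇔ InB h p))
mainTheorem3 h _ ca = (λ { (_ , _ , _) → IsP⇔Valid×Z }) , (λ { (_ , _ , _) → IsN⇔Valid×¬Z })
  where
  open Classification {h} (λ p → nimSum p ≟ 0) (nimSum≡0⇒options≢0 ca) (nimSum≢0⇒option≡0 ca)
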